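{- If $e:[\forall\underline{x}.]\ \Rightarrow B$ is derivable given axioms $\Phi$, then $e$ is beta-normalizable to a first-order proof term.
   Context: First-order terms $t ::= x \mid f(t_1,\dots,t_n)$; atomic formulas $P(t_1,\dots,t_n)$; Horn formulas $F ::= [\forall \underline{x}].\ A_1,\dots,A_n \Rightarrow A$ ($n\ge0$; for $n=0$ written $\Rightarrow A$), where $\forall\underline{x}.F$ quantifies all free term variables of $F$ and $[\forall\underline{x}].F$ means $F$ or $\forall\underline{x}.F$. Proof terms $p,e ::= \kappa \mid a \mid \lambda a.e \mid e\ e'$ ($\kappa$ proof-term constants, $a$ proof-term variables); beta-reduction is the congruence closure of $(\lambda a.p)p'\to_\beta[p'/a]p$. A proof term is first-order if it is built from proof-term variables and constants by application only. A logic program $\Phi$ is a list of closed Horn formulas labelled by distinct proof-term constants. Typing $e:F$ given $\Phi$ is generated by: (axiom) $\kappa:\forall\underline{x}.F$ if $(\kappa:\forall\underline{x}.F)\in\Phi$; (gen) from $e:F$ infer $e:\forall\underline{x}.F$; (inst) from $e:\forall\underline{x}.F$ infer $e:[\underline{t}/\underline{x}]F$; (cut) from $e_1:\underline{A}\Rightarrow D$ and $e_2:\underline{B},D\Rightarrow C$ infer $\lambda\underline{a}.\lambda\underline{b}.(e_2\ \underline{b})\ (e_1\ \underline{a}) : \underline{A},\underline{B}\Rightarrow C$, with $\underline{a},\underline{b}$ fresh proof-term variable lists of the lengths of $\underline{A},\underline{B}$. -}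

module Defs where

open import Data.Nat using (ℕ; zero; suc; _+_; _<ᵇ_; _∸_)
open import Data.Bool using (if_then_else_)
open import Data.List using (List; []; _∷_; map; downFrom; foldl; _++_; length)
open import Data.Product using (_×_; _,_; proj₁; ∃)
open import Data.List.Membership.Propositional using (_∈_)
open import Data.List.Relation.Unary.Unique.Propositional using (Unique)
open import Relation.Binary.Construct.Closure.ReflexiveTransitive using (Star)

data Term : Set where
  var : ℕ → Term
  fn  : ℕ → List Term → Term

record Atom : Set where
  constructor atom
  field
    pred : ℕ
    args : List Term

mutual
  substT : (ℕ → Term) → Term → Term
  substT σ (var x)   = σ x
  substT σ (fn f ts) = fn f (substTs σ ts)

  substTs : (ℕ → Term) → List Term → List Term
  substTs σ []       = []
  substTs σ (t ∷ ts) = substT σ t ∷ substTs σ ts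

substA : (ℕ → Term) → Atom → Atom
substA σ (atom P ts) = atom P (substTs σ ts)

-- Horn formulas  A₁,…,Aₙ ⇒ A  and their universal closures ∀x̲. A₁,…,Aₙ ⇒ A
-- (∀x̲ binds all free term variables of the formula).
data Formula : Set where
  _⇒_  : List Atom → Atom → Formula
  ∀[_⇒_] : List Atom → Atom → Formula

-- Proof terms (de Bruijn indices for proof-term variables)

data PT : Set where
  con : ℕ → PT
  pv  : ℕ → PT
  lam : PT → PT
  app : PT → PT → PT

shift : ℕ → ℕ → PT → PT
shift d c (con k)   = con k
shift d c (pv i)    = if i <ᵇ c then pv i else pv (i + d)
shift d c (lam p)   = lam (shift d (suc c) p)
shift d c (app p q) = app (shift d c p) (shift d c q)

subst : ℕ → PT → PT → PT
subst j s (con k)   = con k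
subst j s (pv i)    = if i <ᵇ j then pv i else (if j <ᵇ i then pv (i ∸ 1) else shift j 0 s)
subst j s (lam p)   = lam (subst (suc j) s p)
subst j s (app p q) = app (subst j s p) (subst j s q)

data _→β_ : PT → PT → Set where
  β    : ∀ {p p'} → app (lam p) p' →β subst 0 p' p
  ξlam : ∀ {p q} → p →β q → lam p →β lam q
  ξl   : ∀ {p q r} → p →β q → app p r →β app q r
  ξr   : ∀ {p q r} → p →β q → app r p →β app r q

_↠β_ : PT → PT → Set
_↠β_ = Star _→β_

data FirstOrder : PT → Set where
  fo-con : ∀ {k} → FirstOrder (con k)
  fo-var : ∀ {i} → FirstOrder (pv i)
  fo-app : ∀ {p q} → FirstOrder p → FirstOrder q → FirstOrder (app p q)

lams : ℕ → PT → PT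
lams zero    p = p
lams (suc n) p = lam (lams n p)

apps : PT → List PT → PT
apps = foldl app

-- λa̲.λb̲.(e₂ b̲)(e₁ a̲) with |a̲| = n, |b̲| = m, in de Bruijn form
cutTerm : ℕ → ℕ → PT → PT → PT
cutTerm n m e₁ e₂ =
  lams (n + m)
    (app (apps (shift (n + m) 0 e₂) (map pv (downFrom m)))
         (apps (shift (n + m) 0 e₁) (map (λ k → pv (m + k)) (downFrom n))))

-- A logic program: closed Horn formulas ∀x̲.(A̲ ⇒ A) labelled by constants
Program : Set
Program = List (ℕ × (List Atom × Atom))

WellLabelled : Program → Set
WellLabelled Φ = Unique (map proj₁ Φ)

data _⊢_∶_ (Φ : Program) : PT → Formula → Set where
  axiom : ∀ {κ As A} → (κ , (As , A)) ∈ Φ → Φ ⊢ con κ ∶ ∀[ As ⇒ A ]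
  gen   : ∀ {e As A} → Φ ⊢ e ∶ (As ⇒ A) → Φ ⊢ e ∶ ∀[ As ⇒ A ]
  inst  : ∀ {e As A} (σ : ℕ → Term) → Φ ⊢ e ∶ ∀[ As ⇒ A ]
        → Φ ⊢ e ∶ (map (substA σ) As ⇒ substA σ A)
  cut   : ∀ {e₁ e₂ As Bs C D} → Φ ⊢ e₁ ∶ (As ⇒ D) → Φ ⊢ e₂ ∶ ((Bs ++ D ∷ []) ⇒ C)
        → Φ ⊢ cutTerm (length As) (length Bs) e₁ e₂ ∶ ((As ++ Bs) ⇒ C)

-- Every derivable  e ∶ A₁,…,Aₙ ⇒ A  β-reduces to an abstraction  λa₁…aⱼ. q  with
-- j ≤ n and q first-order. Axioms are constants, and gen/inst change neither e nor n.
-- In a cut, the shifted components are applied to proof-term variables: β then only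
-- substitutes variables into first-order bodies, the reduct of e₁ is left without
-- abstractions, and that of e₂ with at most one, which absorbs the reduct of e₁.
-- For n = 0 the abstraction is empty, which is the theorem.
module Submission where

open import Defs
open import Data.List using ([])
open import Data.Product using (∃; _×_)
open import Data.Sum using (_⊎_)

open import Data.Bool using (true; false)
open import Data.List using (List; _∷_; map; downFrom; length; _++_)
open import Data.List.Properties using (length-++; length-map; length-downFrom)
open import Data.List.Relation.Unary.All using (All; []; _∷_; universal)
open import Data.List.Relation.Unary.All.Properties using (map⁺)
open import Data.Nat using (ℕ; zero; suc; _+_; _<ᵇ_; _<_; _≤_; z≤n; s≤s)
open import Data.Nat.Properties
open import Algebra.Properties.CommutativeSemigroup +-commutativeSemigroup
  using (xy∙z≈x∙zy; xy∙z≈xz∙y)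
open import Data.Product using (_,_)
open import Data.Sum using ([_,_]′)
open import Relation.Binary using (tri<; tri≈; tri>)
open import Relation.Binary.Construct.Closure.ReflexiveTransitive using (ε; _◅_; _◅◅_; gmap)
open import Relation.Binary.PropositionalEquality
  using (_≡_; refl; sym; trans; cong; cong₂; module ≡-Reasoning)
  renaming (subst to transport)
open import Relation.Nullary using (yes; no)

<⇒<ᵇ≡true : ∀ {m n} → m < n → (m <ᵇ n) ≡ true
<⇒<ᵇ≡true {zero}  {suc n} _         = refl
<⇒<ᵇ≡true {suc m} {suc n} (s≤s m<n) = <⇒<ᵇ≡true m<n

≥⇒<ᵇ≡false : ∀ {m n} → n ≤ m → (m <ᵇ n) ≡ false
≥⇒<ᵇ≡false {m}     {zero}  _         = refl
≥⇒<ᵇ≡false {suc m} {suc n} (s≤s n≤m) = ≥⇒<ᵇ≡false n≤m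

shift-pv-< : ∀ {d c i} → i < c → shift d c (pv i) ≡ pv i
shift-pv-< i<c rewrite <⇒<ᵇ≡true i<c = refl

shift-pv-≥ : ∀ {d c i} → c ≤ i → shift d c (pv i) ≡ pv (i + d)
shift-pv-≥ {i = i} c≤i rewrite ≥⇒<ᵇ≡false {i} c≤i = refl

subst-pv-< : ∀ {j s i} → i < j → subst j s (pv i) ≡ pv i
subst-pv-< i<j rewrite <⇒<ᵇ≡true i<j = refl

subst-pv-≡ : ∀ {j s} → subst j s (pv j) ≡ shift j 0 s
subst-pv-≡ {j} rewrite ≥⇒<ᵇ≡false {j} {j} ≤-refl = refl

subst-pv-> : ∀ {j s i} → j ≤ i → subst j s (pv (suc i)) ≡ pv i
subst-pv-> {j} {i = i} j≤i
  rewrite ≥⇒<ᵇ≡false {suc i} {j} (m≤n⇒m≤1+n j≤i) | <⇒<ᵇ≡true {j} {suc i} (s≤s j≤i) = refl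

shift-shift-comm : ∀ d k j c s →
  shift d (k + (j + c)) (shift j k s) ≡ shift j k (shift d (k + c) s)
shift-shift-comm d k j c (con _)   = refl
shift-shift-comm d k j c (lam s)   = cong lam (shift-shift-comm d (suc k) j c s)
shift-shift-comm d k j c (app s t) = cong₂ app (shift-shift-comm d k j c s) (shift-shift-comm d k j c t)
shift-shift-comm d k j c (pv i) with i <? k | i <? k + c
... | yes i<k | _ = begin
  shift d (k + (j + c)) (shift j k (pv i)) ≡⟨ cong (shift d _) (shift-pv-< i<k) ⟩
  shift d (k + (j + c)) (pv i)             ≡⟨ shift-pv-< (<-≤-trans i<k (m≤m+n k _)) ⟩
  pv i                                     ≡⟨ shift-pv-< i<k ⟨
  shift j k (pv i)                         ≡⟨ cong (shift j k) (shift-pv-< (<-≤-trans i<k (m≤m+n k c))) ⟨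
  shift j k (shift d (k + c) (pv i))       ∎
  where open ≡-Reasoning
... | no i≮k | yes i<k+c = begin
  shift d (k + (j + c)) (shift j k (pv i)) ≡⟨ cong (shift d _) (shift-pv-≥ (≮⇒≥ i≮k)) ⟩
  shift d (k + (j + c)) (pv (i + j))       ≡⟨ shift-pv-< i+j<k+[j+c] ⟩
  pv (i + j)                               ≡⟨ shift-pv-≥ (≮⇒≥ i≮k) ⟨
  shift j k (pv i)                         ≡⟨ cong (shift j k) (shift-pv-< i<k+c) ⟨
  shift j k (shift d (k + c) (pv i))       ∎
  where
  open ≡-Reasoning
  i+j<k+[j+c] : i + j < k + (j + c)
  i+j<k+[j+c] = transport (i + j <_) (xy∙z≈x∙zy k c j) (+-monoˡ-< j i<k+c)
... | no i≮k | no i≮k+c = begin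
  shift d (k + (j + c)) (shift j k (pv i)) ≡⟨ cong (shift d _) (shift-pv-≥ (≮⇒≥ i≮k)) ⟩
  shift d (k + (j + c)) (pv (i + j))       ≡⟨ shift-pv-≥ k+[j+c]≤i+j ⟩
  pv (i + j + d)                           ≡⟨ cong pv (xy∙z≈xz∙y i j d) ⟩
  pv (i + d + j)                           ≡⟨ shift-pv-≥ (≤-trans (≮⇒≥ i≮k) (m≤m+n i d)) ⟨
  shift j k (pv (i + d))                   ≡⟨ cong (shift j k) (shift-pv-≥ (≮⇒≥ i≮k+c)) ⟨
  shift j k (shift d (k + c) (pv i))       ∎
  where
  open ≡-Reasoning
  k+[j+c]≤i+j : k + (j + c) ≤ i + j
  k+[j+c]≤i+j = transport (_≤ i + j) (xy∙z≈x∙zy k c j) (+-monoˡ-≤ j (≮⇒≥ i≮k+c))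

subst-shift-comm : ∀ d j c s p →
  shift d (j + c) (subst j s p) ≡ subst j (shift d c s) (shift d (suc (j + c)) p)
subst-shift-comm d j c s (con _)   = refl
subst-shift-comm d j c s (lam p)   = cong lam (subst-shift-comm d (suc j) c s p)
subst-shift-comm d j c s (app p q) = cong₂ app (subst-shift-comm d j c s p) (subst-shift-comm d j c s q)
subst-shift-comm d j c s (pv i) with <-cmp i j
... | tri< i<j _ _ = begin
  shift d (j + c) (subst j s (pv i))                  ≡⟨ cong (shift d _) (subst-pv-< {s = s} i<j) ⟩
  shift d (j + c) (pv i)                              ≡⟨ shift-pv-< (<-≤-trans i<j (m≤m+n j c)) ⟩
  pv i                                                ≡⟨ subst-pv-< {s = shift d c s} i<j ⟨
  subst j (shift d c s) (pv i)                        ≡⟨ cong (subst j _) (shift-pv-< i<1+j+c) ⟨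
  subst j (shift d c s) (shift d (suc (j + c)) (pv i)) ∎
  where
  open ≡-Reasoning
  i<1+j+c : i < suc (j + c)
  i<1+j+c = m<n⇒m<1+n (<-≤-trans i<j (m≤m+n j c))
... | tri≈ _ refl _ = begin
  shift d (j + c) (subst j s (pv j))                  ≡⟨ cong (shift d _) (subst-pv-≡ {s = s}) ⟩
  shift d (j + c) (shift j 0 s)                       ≡⟨ shift-shift-comm d 0 j c s ⟩
  shift j 0 (shift d c s)                             ≡⟨ subst-pv-≡ {s = shift d c s} ⟨
  subst j (shift d c s) (pv j)                        ≡⟨ cong (subst j _) (shift-pv-< (s≤s (m≤m+n j c))) ⟨
  subst j (shift d c s) (shift d (suc (j + c)) (pv j)) ∎
  where open ≡-Reasoning
subst-shift-comm d j c s (pv (suc i)) | tri> _ _ (s≤s j≤i) with i <? j + c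
... | yes i<j+c = begin
  shift d (j + c) (subst j s (pv (suc i)))                  ≡⟨ cong (shift d _) (subst-pv-> {s = s} j≤i) ⟩
  shift d (j + c) (pv i)                                    ≡⟨ shift-pv-< i<j+c ⟩
  pv i                                                      ≡⟨ subst-pv-> {s = shift d c s} j≤i ⟨
  subst j (shift d c s) (pv (suc i))                        ≡⟨ cong (subst j _) (shift-pv-< (s≤s i<j+c)) ⟨
  subst j (shift d c s) (shift d (suc (j + c)) (pv (suc i))) ∎
  where open ≡-Reasoning
... | no i≮j+c = begin
  shift d (j + c) (subst j s (pv (suc i)))                  ≡⟨ cong (shift d _) (subst-pv-> {s = s} j≤i) ⟩
  shift d (j + c) (pv i)                                    ≡⟨ shift-pv-≥ (≮⇒≥ i≮j+c) ⟩
  pv (i + d)                                                ≡⟨ subst-pv-> {s = shift d c s} (≤-trans j≤i (m≤m+n i d)) ⟨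
  subst j (shift d c s) (pv (suc i + d))                    ≡⟨ cong (subst j _) (shift-pv-≥ (s≤s (≮⇒≥ i≮j+c))) ⟨
  subst j (shift d c s) (shift d (suc (j + c)) (pv (suc i))) ∎
  where open ≡-Reasoning

shift-lams : ∀ d c k q → shift d c (lams k q) ≡ lams k (shift d (k + c) q)
shift-lams d c zero    q = refl
shift-lams d c (suc k) q =
  cong lam (trans (shift-lams d (suc c) k q) (cong (λ c′ → lams k (shift d c′ q)) (+-suc k c)))

subst-lams : ∀ j s k q → subst j s (lams k q) ≡ lams k (subst (k + j) s q)
subst-lams j s zero    q = refl
subst-lams j s (suc k) q =
  cong lam (trans (subst-lams (suc j) s k q) (cong (λ j′ → lams k (subst j′ s q)) (+-suc k j)))

lams-+ : ∀ k n q → lams k (lams n q) ≡ lams (k + n) q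
lams-+ zero    n q = refl
lams-+ (suc k) n q = cong lam (lams-+ k n q)

shift-→β : ∀ d c {p q} → p →β q → shift d c p →β shift d c q
shift-→β d c (β {p} {p′}) =
  transport (shift d c (app (lam p) p′) →β_) (sym (subst-shift-comm d 0 c p′ p)) β
shift-→β d c (ξlam r) = ξlam (shift-→β d (suc c) r)
shift-→β d c (ξl r)   = ξl (shift-→β d c r)
shift-→β d c (ξr r)   = ξr (shift-→β d c r)

shift-↠β : ∀ d c {p q} → p ↠β q → shift d c p ↠β shift d c q
shift-↠β d c = gmap (shift d c) (shift-→β d c)

lams-↠β : ∀ k {p q} → p ↠β q → lams k p ↠β lams k q
lams-↠β zero    r = r
lams-↠β (suc k) r = gmap lam ξlam (lams-↠β k r)

app-↠β : ∀ {p p′ q q′} → p ↠β p′ → q ↠β q′ → app p q ↠β app p′ q′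
app-↠β r s = gmap (λ p → app p _) ξl r ◅◅ gmap (app _) ξr s

apps-↠β : ∀ {p q} args → p ↠β q → apps p args ↠β apps q args
apps-↠β []         r = r
apps-↠β (a ∷ args) r = apps-↠β args (app-↠β r ε)

shift-FirstOrder : ∀ d c {q} → FirstOrder q → FirstOrder (shift d c q)
shift-FirstOrder d c fo-con           = fo-con
shift-FirstOrder d c (fo-var {i}) with i <ᵇ c
... | true  = fo-var
... | false = fo-var
shift-FirstOrder d c (fo-app fp fq) = fo-app (shift-FirstOrder d c fp) (shift-FirstOrder d c fq)

subst-FirstOrder : ∀ j {s q} → FirstOrder s → FirstOrder q → FirstOrder (subst j s q)
subst-FirstOrder j fs fo-con           = fo-con
subst-FirstOrder j fs (fo-var {i}) with i <ᵇ j | j <ᵇ i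
... | true  | _     = fo-var
... | false | true  = fo-var
... | false | false = shift-FirstOrder j 0 fs
subst-FirstOrder j fs (fo-app fp fq) = fo-app (subst-FirstOrder j fs fp) (subst-FirstOrder j fs fq)

record _↠FO-λ≤_ (e : PT) (n : ℕ) : Set where
  constructor reduces
  field
    arity      : ℕ
    body       : PT
    arity≤     : arity ≤ n
    reduction  : e ↠β lams arity body
    firstOrder : FirstOrder body

↠FO-λ≤-mono : ∀ {e m n} → m ≤ n → e ↠FO-λ≤ m → e ↠FO-λ≤ n
↠FO-λ≤-mono m≤n (reduces j q j≤m r fq) = reduces j q (≤-trans j≤m m≤n) r fq

FirstOrder⇒↠FO-λ≤0 : ∀ {e} → FirstOrder e → e ↠FO-λ≤ 0
FirstOrder⇒↠FO-λ≤0 fe = reduces 0 _ z≤n ε fe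

↠FO-λ≤0⇒normalizable : ∀ {e} → e ↠FO-λ≤ 0 → ∃ λ p → (e ↠β p) × FirstOrder p
↠FO-λ≤0⇒normalizable (reduces 0 q z≤n r fq) = q , r , fq

shift-↠FO-λ≤ : ∀ d c {e n} → e ↠FO-λ≤ n → shift d c e ↠FO-λ≤ n
shift-↠FO-λ≤ d c (reduces j q j≤n r fq) =
  reduces j (shift d (j + c) q) j≤n
    (transport (_ ↠β_) (shift-lams d c j q) (shift-↠β d c r))
    (shift-FirstOrder d (j + c) fq)

app-↠FO-λ≤ : ∀ {f a n} → f ↠FO-λ≤ suc n → a ↠FO-λ≤ 0 → app f a ↠FO-λ≤ n
app-↠FO-λ≤ (reduces zero q _ rf fq) a↠ with ↠FO-λ≤0⇒normalizable a↠
... | a′ , ra , fa′ = reduces 0 (app q a′) z≤n (app-↠β rf ra) (fo-app fq fa′)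
app-↠FO-λ≤ (reduces (suc j) q (s≤s j≤n) rf fq) a↠ with ↠FO-λ≤0⇒normalizable a↠
... | a′ , ra , fa′ =
  reduces j (subst (j + 0) a′ q) j≤n
    (app-↠β rf ra ◅◅ transport (app (lam (lams j q)) a′ ↠β_) (subst-lams 0 a′ j q) (β ◅ ε))
    (subst-FirstOrder (j + 0) fa′ fq)

apps-↠FO-λ≤ : ∀ {e n} args → e ↠FO-λ≤ (length args + n) → All FirstOrder args → apps e args ↠FO-λ≤ n
apps-↠FO-λ≤ []         e↠ []          = e↠
apps-↠FO-λ≤ (a ∷ args) e↠ (fa ∷ fargs) =
  apps-↠FO-λ≤ args (app-↠FO-λ≤ e↠ (FirstOrder⇒↠FO-λ≤0 fa)) fargs

lams-↠FO-λ≤ : ∀ k {e n} → e ↠FO-λ≤ n → lams k e ↠FO-λ≤ (k + n)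
lams-↠FO-λ≤ k (reduces j q j≤n r fq) =
  reduces (k + j) q (+-monoʳ-≤ k j≤n) (transport (_ ↠β_) (lams-+ k j q) (lams-↠β k r)) fq

variables-FirstOrder : (g : ℕ → ℕ) (n : ℕ) → All FirstOrder (map (λ k → pv (g k)) (downFrom n))
variables-FirstOrder g n = map⁺ (universal (λ _ → fo-var) (downFrom n))

length-variables : (g : ℕ → ℕ) (n : ℕ) → length (map (λ k → pv (g k)) (downFrom n)) ≡ n
length-variables g n = trans (length-map _ (downFrom n)) (length-downFrom n)

cutTerm-↠FO-λ≤ : ∀ n m {e₁ e₂} → e₁ ↠FO-λ≤ n → e₂ ↠FO-λ≤ suc m → cutTerm n m e₁ e₂ ↠FO-λ≤ (n + m)
cutTerm-↠FO-λ≤ n m {e₁} {e₂} e₁↠ e₂↠ =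
  ↠FO-λ≤-mono (≤-reflexive (+-identityʳ (n + m)))
    (lams-↠FO-λ≤ (n + m) (app-↠FO-λ≤ head argument))
  where
  head : apps (shift (n + m) 0 e₂) (map pv (downFrom m)) ↠FO-λ≤ 1
  head = apps-↠FO-λ≤ (map pv (downFrom m))
    (↠FO-λ≤-mono (≤-reflexive (trans (+-comm 1 m) (cong (_+ 1) (sym (length-variables (λ k → k) m)))))
      (shift-↠FO-λ≤ (n + m) 0 e₂↠))
    (variables-FirstOrder (λ k → k) m)
  argument : apps (shift (n + m) 0 e₁) (map (λ k → pv (m + k)) (downFrom n)) ↠FO-λ≤ 0
  argument = apps-↠FO-λ≤ (map (λ k → pv (m + k)) (downFrom n))
    (↠FO-λ≤-mono (≤-reflexive (trans (sym (+-identityʳ n)) (cong (_+ 0) (sym (length-variables (m +_) n)))))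
      (shift-↠FO-λ≤ (n + m) 0 e₁↠))
    (variables-FirstOrder (m +_) n)

premises : Formula → List Atom
premises (As ⇒ _)   = As
premises ∀[ As ⇒ _ ] = As

⊢⇒↠FO-λ≤ : ∀ {Φ e F} → Φ ⊢ e ∶ F → e ↠FO-λ≤ length (premises F)
⊢⇒↠FO-λ≤ (axiom _)                = ↠FO-λ≤-mono z≤n (FirstOrder⇒↠FO-λ≤0 fo-con)
⊢⇒↠FO-λ≤ (gen d)                  = ⊢⇒↠FO-λ≤ d
⊢⇒↠FO-λ≤ (inst {As = As} σ d)     =
  ↠FO-λ≤-mono (≤-reflexive (sym (length-map (substA σ) As))) (⊢⇒↠FO-λ≤ d)
⊢⇒↠FO-λ≤ (cut {As = As} {Bs} d₁ d₂) =
  ↠FO-λ≤-mono (≤-reflexive (sym (length-++ As)))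
    (cutTerm-↠FO-λ≤ (length As) (length Bs) (⊢⇒↠FO-λ≤ d₁)
      (↠FO-λ≤-mono (≤-reflexive (trans (length-++ Bs) (+-comm (length Bs) 1))) (⊢⇒↠FO-λ≤ d₂)))

theorem3 : (Φ : Program) → WellLabelled Φ → (e : PT) (B : Atom)
    → (Φ ⊢ e ∶ ([] ⇒ B)) ⊎ (Φ ⊢ e ∶ ∀[ [] ⇒ B ])
    → ∃ λ p → (e ↠β p) × FirstOrder p
theorem3 Φ _ e B d = ↠FO-λ≤0⇒normalizable ([ ⊢⇒↠FO-λ≤ , ⊢⇒↠FO-λ≤ ]′ d)
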